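{- Let $q\geqslant 2$ be an even integer, let $n=n_1+\dots+n_r$ with $n_1,\dots,n_r$ positive even integers, and for $k=1,\dots,r$ let $f_k:\mathbb{F}_2^{n_k}\to\mathbb{Z}_q$ be a regular generalized bent function whose dual satisfies $\widetilde{f}_k=f_k+c_k\frac{q}{2}$ for some $c_k\in\{0,1\}$. Define $f:\mathbb{F}_2^n\to\mathbb{Z}_q$ by $f(x)=f_1(x^{(1)})+f_2(x^{(2)})+\dots+f_r(x^{(r)})$, where $x=(x^{(1)},\dots,x^{(r)})$ with $x^{(k)}\in\mathbb{F}_2^{n_k}$. If the number of indices $k$ with $c_k=1$ is even, then $f$ is a self-dual generalized bent function in $n$ variables.
   Context: For $f:\mathbb{F}_2^n\to\mathbb{Z}_q$ and $\omega=e^{2\pi i/q}$, the generalized Walsh–Hadamard transform is $H_f(y)=\sum_{x\in\mathbb{F}_2^n}\omega^{f(x)}(-1)^{\langle x,y\rangle}$, where $\langle x,y\rangle=\bigoplus_i x_iy_i$. $f$ is generalized bent (gbent) if $|H_f(y)|=2^{n/2}$ for all $y$; it is regular if there is $\widetilde f:\mathbb{F}_2^n\to\mathbb{Z}_q$ (its dual) with $H_f(y)=2^{n/2}\omega^{\widetilde f(y)}$ for all $y$. A regular gbent $f$ is self-dual if $\widetilde f=f$ and anti-self-dual if $\widetilde f=f+q/2$. -}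

module Defs where

open import Level using (Level)
open import Data.Bool using (Bool; true; false; _xor_; _∧_)
open import Data.Nat using (ℕ; zero; suc; NonZero)
import Data.Nat as N
open import Data.Nat.DivMod using (_mod_; _/_)
open import Data.Fin using (Fin; toℕ)
open import Data.Vec using (Vec; []; _∷_; take; drop; lookup; tabulate)
import Data.Vec as Vec
open import Data.List using (List; []; _∷_; map; _++_; foldr)
open import Algebra.Bundles using (CommutativeRing)

-- F_2^n is modelled as Vec Bool n; Z_q is modelled as Fin q.


module _ (q : ℕ) .{{_ : NonZero q}} where
  addq : Fin q → Fin q → Fin q
  addq a b = (toℕ a N.+ toℕ b) mod q

  zeroq : Fin q
  zeroq = 0 mod q

  shiftq : Fin 2 → Fin q
  shiftq c = (toℕ c N.* (q / 2)) mod q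

allVecs : (n : ℕ) → List (Vec Bool n)
allVecs zero = [] ∷ []
allVecs (suc n) = map (false ∷_) (allVecs n) ++ map (true ∷_) (allVecs n)

inner : ∀ {n} → Vec Bool n → Vec Bool n → Bool
inner [] [] = false
inner (a ∷ x) (b ∷ y) = (a ∧ b) xor inner x y

combine : (q : ℕ) .{{_ : NonZero q}} → ∀ {r} (ns : Vec ℕ r) →
          ((k : Fin r) → Vec Bool (lookup ns k) → Fin q) →
          Vec Bool (Vec.sum ns) → Fin q
combine q [] fs x = zeroq q
combine q (m ∷ ns) fs x =
  addq q (fs Fin.zero (take m x)) (combine q ns (λ k → fs (Fin.suc k)) (drop m x))
  where import Data.Fin as Fin

count1 : ∀ {r} → (Fin r → Fin 2) → ℕ
count1 c = Vec.sum (tabulate (λ k → toℕ (c k)))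

module Ring {c ℓ : Level} (R : CommutativeRing c ℓ) where
  open CommutativeRing R

  pow : Carrier → ℕ → Carrier
  pow x zero = 1#
  pow x (suc k) = x * pow x k

  sign : Bool → Carrier
  sign false = 1#
  sign true = - 1#

  walsh : (ω : Carrier) {q n : ℕ} → (Vec Bool n → Fin q) → Vec Bool n → Carrier
  walsh ω {q} {n} f y =
    foldr (λ x acc → (pow ω (toℕ (f x)) * sign (inner x y)) + acc) 0# (allVecs n)

  two : Carrier
  two = 1# + 1#

  PrimitiveRoot : ℕ → Carrier → Set ℓ
  PrimitiveRoot q ω = (pow ω q ≈ 1#) Data.Product.× (∀ j → 0 Data.Nat.< j → j Data.Nat.< q → ¬ (pow ω j ≈ 1#))
    where import Data.Product
          import Data.Nat
          open import Relation.Nullary using (¬_)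

  RegularWithDual : (ω : Carrier) (q n : ℕ) → (Vec Bool n → Fin q) → (Vec Bool n → Fin q) → Set ℓ
  RegularWithDual ω q n f g = ∀ y → walsh ω f y ≈ pow two (n / 2) * pow ω (toℕ (g y))

{-# OPTIONS --safe #-}
-- The Walsh–Hadamard transform of a direct sum f(x) + g(x') factors as H_f(y) H_g(y'), so a
-- direct sum of regular gbent functions is regular and its dual is the direct sum of the duals.
-- Here that dual is f + (Σ c_k) q/2; reduction mod q is invisible to powers of ω since ω^q = 1,
-- and ω^{(Σ c_k) q/2} = 1 as soon as Σ c_k is even.
module Submission where

open import Defs
open import Level using (Level)
open import Function using (_∘_)
open import Data.Bool using (Bool; true; false; _xor_; _∧_)
open import Data.Bool.Properties using (xor-assoc)
open import Data.Nat using (ℕ; zero; suc; NonZero; _≤_; _<_)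
import Data.Nat as ℕ
import Data.Nat.Properties as ℕₚ
open import Data.Nat.DivMod using (_mod_; _/_; _%_; m≡m%n+[m/n]*n; m%n<n; m*n/n≡m; +-distrib-/-∣ˡ)
open import Data.Nat.Divisibility using (_∣_; divides)
open import Data.Fin using (Fin; toℕ)
import Data.Fin as Fin
open import Data.Fin.Properties using (toℕ-fromℕ<)
open import Data.Vec using (Vec; []; _∷_; _++_; take; drop; lookup; sum)
open import Data.Vec.Properties using (take++drop≡id)
open import Data.List using (List; map; foldr) renaming (_++_ to _++ˡ_; _∷_ to _∷ˡ_; [] to []ˡ)
open import Data.Product using (_,_)
open import Algebra.Bundles using (CommutativeRing)
open import Relation.Binary.PropositionalEquality as ≡ using (_≡_)

module _ {A : Set} where

  take-++ : ∀ m {n} (xs : Vec A m) (ys : Vec A n) → take m (xs ++ ys) ≡ xs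
  take-++ zero    []       ys = ≡.refl
  take-++ (suc m) (x ∷ xs) ys = ≡.cong (x ∷_) (take-++ m xs ys)

  drop-++ : ∀ m {n} (xs : Vec A m) (ys : Vec A n) → drop m (xs ++ ys) ≡ ys
  drop-++ zero    []       ys = ≡.refl
  drop-++ (suc m) (x ∷ xs) ys = drop-++ m xs ys

inner-++ : ∀ {m n} (x y : Vec Bool m) (x′ y′ : Vec Bool n) →
           inner (x ++ x′) (y ++ y′) ≡ inner x y xor inner x′ y′
inner-++ []      []      x′ y′ = ≡.refl
inner-++ (a ∷ x) (b ∷ y) x′ y′ =
  ≡.trans (≡.cong ((a ∧ b) xor_) (inner-++ x y x′ y′)) (≡.sym (xor-assoc (a ∧ b) _ _))

double*half≡* : ∀ j p → j ℕ.* 2 ℕ.* (p ℕ.* 2 / 2) ≡ j ℕ.* (p ℕ.* 2)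
double*half≡* j p = begin
  j ℕ.* 2 ℕ.* (p ℕ.* 2 / 2) ≡⟨ ≡.cong (j ℕ.* 2 ℕ.*_) (m*n/n≡m p 2) ⟩
  j ℕ.* 2 ℕ.* p             ≡⟨ ℕₚ.*-assoc j 2 p ⟩
  j ℕ.* (2 ℕ.* p)           ≡⟨ ≡.cong (j ℕ.*_) (ℕₚ.*-comm 2 p) ⟩
  j ℕ.* (p ℕ.* 2)           ∎
  where open ≡.≡-Reasoning

directSum : (q : ℕ) .{{_ : NonZero q}} {m n : ℕ} →
            (Vec Bool m → Fin q) → (Vec Bool n → Fin q) → Vec Bool (m ℕ.+ n) → Fin q
directSum q {m} f g x = addq q (f (take m x)) (g (drop m x))

module _ {c ℓ : Level} (R : CommutativeRing c ℓ) where
  open CommutativeRing R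
  open Ring R
  open import Relation.Binary.Reasoning.Setoid setoid
  open import Algebra.Properties.Ring ring using (-1*x≈-x; -‿involutive)
  open import Algebra.Properties.CommutativeSemigroup *-commutativeSemigroup using (interchange)

  sumOver : {A : Set} → List A → (A → Carrier) → Carrier
  sumOver xs h = foldr (λ x acc → h x + acc) 0# xs

  sumOver-++ : {A : Set} (xs ys : List A) (h : A → Carrier) →
               sumOver (xs ++ˡ ys) h ≈ sumOver xs h + sumOver ys h
  sumOver-++ []ˡ       ys h = sym (+-identityˡ _)
  sumOver-++ (x ∷ˡ xs) ys h = trans (+-congˡ (sumOver-++ xs ys h)) (sym (+-assoc _ _ _))

  sumOver-map : {A B : Set} (g : A → B) (xs : List A) (h : B → Carrier) →
                sumOver (map g xs) h ≡ sumOver xs (λ x → h (g x))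
  sumOver-map g []ˡ       h = ≡.refl
  sumOver-map g (x ∷ˡ xs) h = ≡.cong (h (g x) +_) (sumOver-map g xs h)

  sumOver-cong : {A : Set} (xs : List A) {h h′ : A → Carrier} →
                 (∀ x → h x ≈ h′ x) → sumOver xs h ≈ sumOver xs h′
  sumOver-cong []ˡ       h≈h′ = refl
  sumOver-cong (x ∷ˡ xs) h≈h′ = +-cong (h≈h′ x) (sumOver-cong xs h≈h′)

  *-distribˡ-sumOver : {A : Set} (u : Carrier) (xs : List A) (h : A → Carrier) →
                       u * sumOver xs h ≈ sumOver xs (λ x → u * h x)
  *-distribˡ-sumOver u []ˡ       h = zeroʳ u
  *-distribˡ-sumOver u (x ∷ˡ xs) h = trans (distribˡ u _ _) (+-congˡ (*-distribˡ-sumOver u xs h))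

  sumOver-product : {A B : Set} (xs : List A) (ys : List B) (u : A → Carrier) (v : B → Carrier) →
                    sumOver xs (λ a → sumOver ys (λ b → u a * v b)) ≈ sumOver xs u * sumOver ys v
  sumOver-product xs ys u v = begin
    sumOver xs (λ a → sumOver ys (λ b → u a * v b)) ≈⟨ sumOver-cong xs (λ a → *-distribˡ-sumOver (u a) ys v) ⟨
    sumOver xs (λ a → u a * sumOver ys v)            ≈⟨ sumOver-cong xs (λ a → *-comm (u a) _) ⟩
    sumOver xs (λ a → sumOver ys v * u a)            ≈⟨ *-distribˡ-sumOver _ xs u ⟨
    sumOver ys v * sumOver xs u                      ≈⟨ *-comm _ _ ⟩
    sumOver xs u * sumOver ys v                      ∎

  sumOver-allVecs-suc : ∀ n (h : Vec Bool (suc n) → Carrier) →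
    sumOver (allVecs (suc n)) h ≈
    sumOver (allVecs n) (λ x → h (false ∷ x)) + sumOver (allVecs n) (λ x → h (true ∷ x))
  sumOver-allVecs-suc n h = begin
    sumOver (map (false ∷_) (allVecs n) ++ˡ map (true ∷_) (allVecs n)) h
      ≈⟨ sumOver-++ (map (false ∷_) (allVecs n)) _ h ⟩
    sumOver (map (false ∷_) (allVecs n)) h + sumOver (map (true ∷_) (allVecs n)) h
      ≡⟨ ≡.cong₂ _+_ (sumOver-map (false ∷_) (allVecs n) h) (sumOver-map (true ∷_) (allVecs n) h) ⟩
    sumOver (allVecs n) (λ x → h (false ∷ x)) + sumOver (allVecs n) (λ x → h (true ∷ x)) ∎

  sumOver-allVecs-++ : ∀ m n (h : Vec Bool (m ℕ.+ n) → Carrier) →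
    sumOver (allVecs (m ℕ.+ n)) h ≈ sumOver (allVecs m) (λ x → sumOver (allVecs n) (λ x′ → h (x ++ x′)))
  sumOver-allVecs-++ zero    n h = sym (+-identityʳ _)
  sumOver-allVecs-++ (suc m) n h = begin
    sumOver (allVecs (suc m ℕ.+ n)) h
      ≈⟨ sumOver-allVecs-suc (m ℕ.+ n) h ⟩
    sumOver (allVecs (m ℕ.+ n)) (λ x → h (false ∷ x)) + sumOver (allVecs (m ℕ.+ n)) (λ x → h (true ∷ x))
      ≈⟨ +-cong (sumOver-allVecs-++ m n (λ x → h (false ∷ x))) (sumOver-allVecs-++ m n (λ x → h (true ∷ x))) ⟩
    sumOver (allVecs m) (λ x → k (false ∷ x)) + sumOver (allVecs m) (λ x → k (true ∷ x))
      ≈⟨ sumOver-allVecs-suc m k ⟨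
    sumOver (allVecs (suc m)) k ∎
    where
    k : Vec Bool (suc m) → Carrier
    k x = sumOver (allVecs n) (λ x′ → h (x ++ x′))

  sign-xor : ∀ a b → sign (a xor b) ≈ sign a * sign b
  sign-xor false b     = sym (*-identityˡ _)
  sign-xor true  false = sym (*-identityʳ _)
  sign-xor true  true  = sym (trans (-1*x≈-x (- 1#)) (-‿involutive 1#))

  pow-+ : ∀ x a b → pow x (a ℕ.+ b) ≈ pow x a * pow x b
  pow-+ x zero    b = sym (*-identityˡ _)
  pow-+ x (suc a) b = trans (*-congˡ (pow-+ x a b)) (sym (*-assoc _ _ _))

  module _ {ω : Carrier} {q : ℕ} .{{_ : NonZero q}} (ωᵠ≈1 : pow ω q ≈ 1#) where

    pow-multiple : ∀ j → pow ω (j ℕ.* q) ≈ 1#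
    pow-multiple zero    = refl
    pow-multiple (suc j) = trans (pow-+ ω q (j ℕ.* q)) (trans (*-cong ωᵠ≈1 (pow-multiple j)) (*-identityˡ 1#))

    pow-mod : ∀ k → pow ω (toℕ (k mod q)) ≈ pow ω k
    pow-mod k = begin
      pow ω (toℕ (k mod q))               ≡⟨ ≡.cong (pow ω) (toℕ-fromℕ< (m%n<n k q)) ⟩
      pow ω (k % q)                       ≈⟨ *-identityʳ _ ⟨
      pow ω (k % q) * 1#                  ≈⟨ *-congˡ (pow-multiple (k / q)) ⟨
      pow ω (k % q) * pow ω (k / q ℕ.* q) ≈⟨ pow-+ ω (k % q) _ ⟨
      pow ω (k % q ℕ.+ k / q ℕ.* q)       ≡⟨ ≡.cong (pow ω) (m≡m%n+[m/n]*n k q) ⟨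
      pow ω k                             ∎

    pow-addq : ∀ a b → pow ω (toℕ (addq q a b)) ≈ pow ω (toℕ a) * pow ω (toℕ b)
    pow-addq a b = trans (pow-mod _) (pow-+ ω (toℕ a) (toℕ b))

    pow-directSum : ∀ {m n} (f : Vec Bool m → Fin q) (g : Vec Bool n → Fin q) x x′ →
                    pow ω (toℕ (directSum q f g (x ++ x′))) ≈ pow ω (toℕ (f x)) * pow ω (toℕ (g x′))
    pow-directSum {m} f g x x′
      rewrite take-++ m x x′ | drop-++ m x x′ = pow-addq (f x) (g x′)

    walsh-directSum : ∀ {m n} (f : Vec Bool m → Fin q) (g : Vec Bool n → Fin q) y y′ →
                      walsh ω (directSum q f g) (y ++ y′) ≈ walsh ω f y * walsh ω g y′
    walsh-directSum {m} {n} f g y y′ = begin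
      walsh ω (directSum q f g) (y ++ y′)
        ≈⟨ sumOver-allVecs-++ m n _ ⟩
      sumOver (allVecs m) (λ x → sumOver (allVecs n) (λ x′ → term x x′))
        ≈⟨ sumOver-cong (allVecs m) (λ x → sumOver-cong (allVecs n) (term-factors x)) ⟩
      sumOver (allVecs m) (λ x → sumOver (allVecs n) (λ x′ → u x * v x′))
        ≈⟨ sumOver-product (allVecs m) (allVecs n) u v ⟩
      walsh ω f y * walsh ω g y′ ∎
      where
      term : Vec Bool m → Vec Bool n → Carrier
      term x x′ = pow ω (toℕ (directSum q f g (x ++ x′))) * sign (inner (x ++ x′) (y ++ y′))
      u : Vec Bool m → Carrier
      u x = pow ω (toℕ (f x)) * sign (inner x y)
      v : Vec Bool n → Carrier
      v x′ = pow ω (toℕ (g x′)) * sign (inner x′ y′)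
      term-factors : ∀ x x′ → term x x′ ≈ u x * v x′
      term-factors x x′ rewrite inner-++ x y x′ y′ =
        trans (*-cong (pow-directSum f g x x′) (sign-xor (inner x y) (inner x′ y′))) (interchange _ _ _ _)

    regular-directSum : ∀ {m n} (f f̃ : Vec Bool m → Fin q) (g g̃ : Vec Bool n → Fin q) → 2 ∣ m →
                        RegularWithDual ω q m f f̃ → RegularWithDual ω q n g g̃ →
                        RegularWithDual ω q (m ℕ.+ n) (directSum q f g) (directSum q f̃ g̃)
    regular-directSum {m} {n} f f̃ g g̃ 2∣m f-reg g-reg y =
      ≡.subst Claim (take++drop≡id m y) (claim (take m y) (drop m y))
      where
      Claim : Vec Bool (m ℕ.+ n) → Set ℓ
      Claim y = walsh ω (directSum q f g) y ≈ pow two ((m ℕ.+ n) / 2) * pow ω (toℕ (directSum q f̃ g̃ y))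
      claim : ∀ y y′ → Claim (y ++ y′)
      claim y y′ = begin
        walsh ω (directSum q f g) (y ++ y′)
          ≈⟨ walsh-directSum f g y y′ ⟩
        walsh ω f y * walsh ω g y′
          ≈⟨ *-cong (f-reg y) (g-reg y′) ⟩
        (pow two (m / 2) * pow ω (toℕ (f̃ y))) * (pow two (n / 2) * pow ω (toℕ (g̃ y′)))
          ≈⟨ interchange _ _ _ _ ⟩
        (pow two (m / 2) * pow two (n / 2)) * (pow ω (toℕ (f̃ y)) * pow ω (toℕ (g̃ y′)))
          ≈⟨ *-cong (pow-+ two (m / 2) (n / 2)) (pow-directSum f̃ g̃ y y′) ⟨
        pow two (m / 2 ℕ.+ n / 2) * pow ω (toℕ (directSum q f̃ g̃ (y ++ y′)))
          ≡⟨ ≡.cong (λ e → pow two e * pow ω (toℕ (directSum q f̃ g̃ (y ++ y′)))) (+-distrib-/-∣ˡ n 2∣m) ⟨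
        pow two ((m ℕ.+ n) / 2) * pow ω (toℕ (directSum q f̃ g̃ (y ++ y′))) ∎

    regular-combine : ∀ {r} (ns : Vec ℕ r) → (∀ k → 2 ∣ lookup ns k) →
                      (fs gs : (k : Fin r) → Vec Bool (lookup ns k) → Fin q) →
                      (∀ k → RegularWithDual ω q (lookup ns k) (fs k) (gs k)) →
                      RegularWithDual ω q (sum ns) (combine q ns fs) (combine q ns gs)
    regular-combine []       even fs gs regular [] =
      trans (+-identityʳ _) (trans (*-identityʳ _) (sym (*-identityˡ _)))
    regular-combine (m ∷ ns) even fs gs regular =
      regular-directSum (fs Fin.zero) (gs Fin.zero) (combine q ns fs′) (combine q ns gs′)
        (even Fin.zero) (regular Fin.zero)
        (regular-combine ns (even ∘ Fin.suc) fs′ gs′ (regular ∘ Fin.suc))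
      where
      fs′ gs′ : (k : Fin _) → Vec Bool (lookup ns k) → Fin q
      fs′ = fs ∘ Fin.suc
      gs′ = gs ∘ Fin.suc

    pow-combine-shift : ∀ {r} (ns : Vec ℕ r) (fs : (k : Fin r) → Vec Bool (lookup ns k) → Fin q)
                        (cs : Fin r → Fin 2) y →
                        pow ω (toℕ (combine q ns (λ k x → addq q (fs k x) (shiftq q (cs k))) y)) ≈
                        pow ω (toℕ (combine q ns fs y)) * pow ω (count1 cs ℕ.* (q / 2))
    pow-combine-shift []       fs cs [] = sym (*-identityʳ _)
    pow-combine-shift (m ∷ ns) fs cs y = begin
      pow ω (toℕ (addq q (addq q a (shiftq q (cs Fin.zero))) b′))
        ≈⟨ pow-addq (addq q a (shiftq q (cs Fin.zero))) b′ ⟩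
      pow ω (toℕ (addq q a (shiftq q (cs Fin.zero)))) * pow ω (toℕ b′)
        ≈⟨ *-cong (trans (pow-addq a (shiftq q (cs Fin.zero))) (*-congˡ (pow-mod (c₀ ℕ.* h))))
                  (pow-combine-shift ns (fs ∘ Fin.suc) (cs ∘ Fin.suc) (drop m y)) ⟩
      (pow ω (toℕ a) * pow ω (c₀ ℕ.* h)) * (pow ω (toℕ b) * pow ω (c′ ℕ.* h))
        ≈⟨ interchange _ _ _ _ ⟩
      (pow ω (toℕ a) * pow ω (toℕ b)) * (pow ω (c₀ ℕ.* h) * pow ω (c′ ℕ.* h))
        ≈⟨ *-cong (pow-addq a b) (pow-+ ω (c₀ ℕ.* h) (c′ ℕ.* h)) ⟨
      pow ω (toℕ (addq q a b)) * pow ω (c₀ ℕ.* h ℕ.+ c′ ℕ.* h)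
        ≡⟨ ≡.cong (λ e → pow ω (toℕ (addq q a b)) * pow ω e) (ℕₚ.*-distribʳ-+ h c₀ c′) ⟨
      pow ω (toℕ (addq q a b)) * pow ω ((c₀ ℕ.+ c′) ℕ.* h) ∎
      where
      h c₀ c′ : ℕ
      h = q / 2
      c₀ = toℕ (cs Fin.zero)
      c′ = count1 (cs ∘ Fin.suc)
      a b b′ : Fin q
      a = fs Fin.zero (take m y)
      b = combine q ns (fs ∘ Fin.suc) (drop m y)
      b′ = combine q ns (λ k x → addq q (fs (Fin.suc k) x) (shiftq q (cs (Fin.suc k)))) (drop m y)

    pow-even-half : ∀ {c} → 2 ∣ c → 2 ∣ q → pow ω (c ℕ.* (q / 2)) ≈ 1#
    pow-even-half (divides j ≡.refl) (divides p q≡p*2) = begin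
      pow ω (j ℕ.* 2 ℕ.* (q / 2))     ≡⟨ ≡.cong (λ e → pow ω (j ℕ.* 2 ℕ.* (e / 2))) q≡p*2 ⟩
      pow ω (j ℕ.* 2 ℕ.* (p ℕ.* 2 / 2)) ≡⟨ ≡.cong (pow ω) (double*half≡* j p) ⟩
      pow ω (j ℕ.* (p ℕ.* 2))         ≡⟨ ≡.cong (λ e → pow ω (j ℕ.* e)) q≡p*2 ⟨
      pow ω (j ℕ.* q)                 ≈⟨ pow-multiple j ⟩
      1#                              ∎

  regular-dual-cong : ∀ {ω q n} (f g g′ : Vec Bool n → Fin q) →
                      (∀ y → pow ω (toℕ (g y)) ≈ pow ω (toℕ (g′ y))) →
                      RegularWithDual ω q n f g → RegularWithDual ω q n f g′
  regular-dual-cong f g g′ g≈g′ f-reg y = trans (f-reg y) (*-congˡ (g≈g′ y))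

proposition1 : ∀ {c ℓ : Level} (R : CommutativeRing c ℓ) (ω : CommutativeRing.Carrier R)
    (q : ℕ) .{{_ : NonZero q}} → 2 ≤ q → 2 ∣ q → Ring.PrimitiveRoot R q ω →
    (r : ℕ) (ns : Vec ℕ r) → (∀ k → 0 < lookup ns k) → (∀ k → 2 ∣ lookup ns k) →
    (fs : (k : Fin r) → Vec Bool (lookup ns k) → Fin q) →
    (cs : Fin r → Fin 2) →
    (∀ k → Ring.RegularWithDual R ω q (lookup ns k) (fs k) (λ y → addq q (fs k y) (shiftq q (cs k)))) →
    2 ∣ count1 cs →
    Ring.RegularWithDual R ω q (sum ns) (combine q ns fs) (combine q ns fs)
proposition1 R ω q _ 2∣q (ωᵠ≈1 , _) r ns _ even fs cs regular 2∣count =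
  regular-dual-cong R (combine q ns fs) dual (combine q ns fs) dual≈f
    (regular-combine R ωᵠ≈1 ns even fs (λ k y → addq q (fs k y) (shiftq q (cs k))) regular)
  where
  open CommutativeRing R
  open Ring R using (pow)
  dual : Vec Bool (sum ns) → Fin q
  dual = combine q ns (λ k x → addq q (fs k x) (shiftq q (cs k)))
  dual≈f : ∀ y → pow ω (toℕ (dual y)) ≈ pow ω (toℕ (combine q ns fs y))
  dual≈f y = trans (pow-combine-shift R ωᵠ≈1 ns fs cs y)
                   (trans (*-congˡ (pow-even-half R ωᵠ≈1 2∣count 2∣q)) (*-identityʳ _))
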